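{- Let $(G,w)$ be a weighted trigraph, let $C$ be a clique-cutset of $G$, and let $(A,B,C)$ be a cut-partition of $G$. Set $G_A=G[A\cup C]$ and $G_B=G[B\cup C]$. For each $C'\subseteq C$, set $\alpha_{A\cup C'}=\alpha(\mathrm{Red}[G_A,w;A\cup C'])+\mathrm{Ext}[G_A,w;A\cup C']$. Define $w_B:D(G_B)\to\mathbb{N}$ by $w_B(c)=\alpha_{A\cup\{c\}}-\alpha_A$ for all $c\in C$, and $w_B(p)=w(p)$ for all $p\in D(G_B)\setminus C$. Then $w_B$ is a weight function for $G_B$, and $\alpha(G,w)=\alpha_A+\alpha(G_B,w_B)$.
   Context: A trigraph $G$ consists of a finite set $V(G)$ and a function $\theta_G:\binom{V(G)}{2}\to\{ -1,0,1\}$; for distinct vertices $u,v$ write $uv$ for $\{u,v\}$; it is strongly adjacent if $\theta_G(uv)=1$, semi-adjacent if $\theta_G(uv)=0$, strongly anti-adjacent if $\theta_G(uv)=-1$; $u,v$ are anti-adjacent if $\theta_G(uv)\le 0$. A stable set is a set of pairwise anti-adjacent vertices; a strong clique is a set of pairwise strongly adjacent vertices. $G[X]$ is the trigraph on $X$ with $\theta_G$ restricted, $G\setminus X=G[V(G)\setminus X]$, and $G$ is connected if the graph on $V(G)$ whose edges are the pairs with $\theta_G\ge 0$ is connected. A clique-cutset is a (possibly empty) strong clique $C$ with $G\setminus C$ disconnected. A cut-partition of $G$ is a partition $(A,B,C)$ of $V(G)$ with $A,B$ non-empty such that every vertex of $A$ is strongly anti-adjacent to every vertex of $B$. Let $D(G)=V(G)\cup\{(u,v):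 u,v\in V(G),u\neq v\}\cup\binom{V(G)}{2}$. A weight function for $G$ is a map $w:D(G)\to\mathbb{N}$ such that for all distinct $u,v$: if $uv$ is not semi-adjacent then $w(u,v)=w(v,u)=w(uv)=0$, and $w(u,v)\le w(uv)$. A weighted trigraph is a pair $(G,w)$; for an induced subtrigraph $H$, $(H,w)$ means $w$ restricted to $D(H)$. For $S\subseteq V(G)$, $\mathrm{wt}_{(G,w)}(S)=\sum_{u\in S}w(u)+\sum_{u\in S}\sum_{v\in V(G)\setminus S}w(u,v)+\sum_{uv\in\binom{V(G)\setminus S}{2}}w(uv)$, and $\alpha(G,w)=\max\{\mathrm{wt}_{(G,w)}(S): S\text{ stable in }G\}$. For $R\subseteq V(G)$, $\mathrm{Red}[G,w;R]$ is the weighted trigraph $(G[R],w')$ where $w'(u)=\max\{w(u)-\sum_{v\in V(G)\setminus R}(w(uv)-w(u,v)),0\}$ for $u\in R$, and $w'(u,v)=w(u,v)$, $w'(uv)=w(uv)$ for distinct $u,v\in R$; and $\mathrm{Ext}[G,w;R]=\sum_{uv\in\binom{V(G)\setminus R}{2}}w(uv)+\sum_{u\in R}\sum_{v\in V(G)\setminus R}w(uv)$. -}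

module Defs where

open import Data.Nat using (ℕ; zero; suc; _+_; _∸_; _≤_; _⊔_; _<ᵇ_)
open import Data.Bool using (Bool; true; false; if_then_else_; _∧_; not)
open import Data.Fin using (Fin; toℕ)
import Data.Fin as F
open import Data.Fin.Subset using (Subset; _∈_; _∉_; _∪_; ⊥; ⁅_⁆; Nonempty)
open import Data.Vec using (Vec; []; _∷_; lookup)
open import Data.Product using (_×_; ∃)
import Data.Sum
import Data.Bool
import Data.Fin.Subset
open import Relation.Binary.PropositionalEquality using (_≡_; _≢_)
open import Relation.Nullary using (¬_)
open import Relation.Nullary.Decidable using (⌊_⌋)

-- Trigraphs on the vertex set Fin n.
-- θ is given on ordered pairs, required symmetric; diagonal values are
-- never used (every condition below only looks at distinct u, v).

data Adj : Set where
  strongAnti semi strong : Adj     -- θ = -1, 0, 1 respectively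

record Trigraph (n : ℕ) : Set where
  field
    θ     : Fin n → Fin n → Adj
    θ-sym : ∀ u v → θ u v ≡ θ v u
open Trigraph public

adjacentᵇ : Adj → Bool
adjacentᵇ strongAnti = false
adjacentᵇ semi       = true
adjacentᵇ strong     = true

antiᵇ : Adj → Bool
antiᵇ strong = false
antiᵇ _      = true

-- Weights on D(G): vertices (wv), ordered pairs (wo u v = w(u,v)),
-- unordered pairs (wu u v = w(uv), symmetric).
record Weights (n : ℕ) : Set where
  field
    wv     : Fin n → ℕ
    wo     : Fin n → Fin n → ℕ
    wu     : Fin n → Fin n → ℕ
    wu-sym : ∀ u v → wu u v ≡ wu v u
open Weights public

-- w is a weight function for the induced subtrigraph G[X]
-- (vertex weights are in ℕ by typing).
IsWeightFunctionOn : ∀ {n} → Trigraph n → Subset n → Weights n → Set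
IsWeightFunctionOn G X w =
  ∀ u v → u ∈ X → v ∈ X → u ≢ v →
    ((θ G u v ≢ semi → (wo w u v ≡ 0 × wo w v u ≡ 0 × wu w u v ≡ 0))
     × wo w u v ≤ wu w u v)

IsWeightFunction : ∀ {n} → Trigraph n → Weights n → Set
IsWeightFunction G w = IsWeightFunctionOn G Data.Fin.Subset.⊤ w

ΣF : ∀ {n} → (Fin n → ℕ) → ℕ
ΣF {zero}  f = 0
ΣF {suc n} f = f F.zero + ΣF (λ i → f (F.suc i))

allF : ∀ {n} → (Fin n → Bool) → Bool
allF {zero}  f = true
allF {suc n} f = f F.zero ∧ allF (λ i → f (F.suc i))

ΣPairs : ∀ {n} → (Fin n → Fin n → ℕ) → ℕ
ΣPairs f = ΣF λ u → ΣF λ v → if toℕ u <ᵇ toℕ v then f u v else 0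

maxSub : ∀ {n} → (Subset n → ℕ) → ℕ
maxSub {zero}  f = f []
maxSub {suc n} f = maxSub (λ S → f (true ∷ S)) ⊔ maxSub (λ S → f (false ∷ S))

[_]· : Bool → ℕ → ℕ
[ b ]· k = if b then k else 0

mem : ∀ {n} → Subset n → Fin n → Bool
mem S i = lookup S i

wt : ∀ {n} → Subset n → Weights n → Subset n → ℕ
wt X w S =
    ΣF (λ u → [ mem S u ]· (wv w u))
  + ΣF (λ u → ΣF (λ v → [ mem S u ∧ mem X v ∧ not (mem S v) ]· (wo w u v)))
  + ΣPairs (λ u v → [ mem X u ∧ not (mem S u) ∧ mem X v ∧ not (mem S v) ]· (wu w u v))

stableᵇ : ∀ {n} → Trigraph n → Subset n → Subset n → Bool
stableᵇ G X S =
  allF (λ u → not (mem S u) Data.Bool.∨ mem X u)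
  ∧ allF (λ u → allF (λ v →
      not (mem S u ∧ mem S v ∧ not ⌊ u F.≟ v ⌋) Data.Bool.∨ antiᵇ (θ G u v)))

-- α(G[X], w): maximum of wt over stable sets of G[X]
-- (the empty set is stable, so replacing non-stable sets by 0 is harmless)
α : ∀ {n} → Trigraph n → Subset n → Weights n → ℕ
α G X w = maxSub (λ S → if stableᵇ G X S then wt X w S else 0)

-- vertex weights of Red[H,w;R] (only used on R; pair weights unchanged)
redWeights : ∀ {n} → Subset n → Subset n → Weights n → Weights n
redWeights Y R w = record
  { wv = λ u → wv w u ∸ ΣF (λ v → [ mem Y v ∧ not (mem R v) ]· (wu w u v ∸ wo w u v))
  ; wo = wo w
  ; wu = wu w
  ; wu-sym = wu-sym w
  }

αRed : ∀ {n} → Trigraph n → Subset n → Subset n → Weights n → ℕ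
αRed G Y R w = α G R (redWeights Y R w)

Ext : ∀ {n} → Subset n → Subset n → Weights n → ℕ
Ext Y R w =
    ΣPairs (λ u v → [ mem Y u ∧ not (mem R u) ∧ mem Y v ∧ not (mem R v) ]· (wu w u v))
  + ΣF (λ u → ΣF (λ v → [ mem R u ∧ mem Y v ∧ not (mem R v) ]· (wu w u v)))

data Path {n} (G : Trigraph n) (X : Subset n) : Fin n → Fin n → Set where
  here : ∀ {u} → Path G X u u
  step : ∀ {u v x} → v ∈ X → adjacentᵇ (θ G u v) ≡ true → Path G X v x → Path G X u x

Connected : ∀ {n} → Trigraph n → Subset n → Set
Connected G X = ∀ u v → u ∈ X → v ∈ X → Path G X u v

StrongClique : ∀ {n} → Trigraph n → Subset n → Set
StrongClique G C = ∀ u v → u ∈ C → v ∈ C → u ≢ v → θ G u v ≡ strong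

compl : ∀ {n} → Subset n → Subset n
compl = Data.Fin.Subset.∁

CliqueCutset : ∀ {n} → Trigraph n → Subset n → Set
CliqueCutset G C = StrongClique G C × ¬ Connected G (compl C)

record CutPartition {n} (G : Trigraph n) (A B C : Subset n) : Set where
  field
    cover      : ∀ v → v ∈ A Data.Sum.⊎ (v ∈ B Data.Sum.⊎ v ∈ C)
    disjAB     : ∀ v → v ∈ A → v ∉ B
    disjAC     : ∀ v → v ∈ A → v ∉ C
    disjBC     : ∀ v → v ∈ B → v ∉ C
    A-nonempty : Nonempty A
    B-nonempty : Nonempty B
    anti       : ∀ a b → a ∈ A → b ∈ B → θ G a b ≡ strongAnti

αPart : ∀ {n} → Trigraph n → Weights n → (A C C' : Subset n) → ℕ
αPart G w A C C' = αRed G (A ∪ C) (A ∪ C') w + Ext (A ∪ C) (A ∪ C') w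

wB : ∀ {n} → Trigraph n → Weights n → (A C : Subset n) → Weights n
wB G w A C = record
  { wv = λ v → if mem C v then αPart G w A C ⁅ v ⁆ ∸ αPart G w A C ⊥ else wv w v
  ; wo = wo w
  ; wu = wu w
  ; wu-sym = wu-sym w
  }

module Submission where

-- Write IsMaxStable G R X w m for "m is the largest wt_X(T) over
-- stable sets T of G[R]"; then α(G[X], w) is such a maximum for R = X, and
--   (Red/Ext)  α(Red[G[Y],w;R]) + Ext[G[Y],w;R] is the maximum of wt_Y over
--              stable sets of G[R],
-- because the pair weight lost when passing from Y to R is restored by Ext,
-- except for w(uv) − w(u,v) which Red charges to the vertices.  Hence α_A
-- and α_{A∪{c}} are maxima over stable sets of G_A inside A, A ∪ {c}.
-- Every stable set S of G meets the strong clique C in at most one vertex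
-- and decomposes as wt(S) + w(S ∩ C) = wt_{G_A}(S ∩ XA) + wt_{G_B}(S ∩ XB);
-- conversely stable sets of G_A, G_B agreeing on C glue to one of G.  This
-- gives both inequalities showing that α_A + α(G_B, w_B) is the maximum of
-- wt over stable sets of G, i.e. equals α(G, w).
--
-- All pair-weight identities are reduced, by symmetrising double sums, to
-- statements about a single pair {u, v}, which are checked by cases on the
-- positions of u and v (pairWt-red, pairWt-shrink, pairWt-split).

open import Defs
open import Data.Nat using (ℕ; zero; suc; _+_; _∸_; _≤_; _≤?_; _<ᵇ_; z≤n)
open import Data.Nat.Properties
open import Data.Bool using (Bool; true; false; _∧_; _∨_; not; if_then_else_)
open import Data.Bool.Properties using (∧-assoc; ∧-comm)
open import Data.Fin using (Fin; toℕ)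
import Data.Fin as F
import Data.Fin.Properties as FP
open import Data.Fin.Subset using (Subset; _∈_; _∉_; _∪_; _∩_; _⊆_; ∁; ⊥; ⊤; ⁅_⁆)
open import Data.Fin.Subset.Properties
  using (_∈?_; ∈⊤; ∉⊥; ⊆⊤; ⊆-min; ⊆-antisym; ∪-identityʳ; p⊆p∪q; q⊆p∪q; x∈p∪q⁻; p∩q⊆p; p∩q⊆q;
         x∈p∩q⁺; x∈p∩q⁻; x∈⁅x⁆; x∈⁅y⁆⇒x≡y; x≢y⇒x∉⁅y⁆; x∈∁p⇒x∉p; x∉p⇒x∈∁p)
open import Data.Vec using ([]; _∷_; tabulate)
open import Data.Vec.Properties using (lookup-zipWith; lookup-replicate; lookup∘tabulate; []=⇒lookup; lookup⇒[]=)
open import Data.Product using (_×_; _,_; proj₁; proj₂; Σ)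
open import Data.Sum using (_⊎_; inj₁; inj₂)
open import Data.Empty using (⊥-elim)
open import Relation.Binary.PropositionalEquality
open import Relation.Nullary using (yes; no)
open import Relation.Nullary.Decidable using (⌊_⌋)
open import Algebra.Properties.CommutativeSemigroup +-commutativeSemigroup
  using (interchange; xy∙z≈xz∙y; x∙yz≈xz∙y; x∙yz≈x∙zy)

∈⇒mem : ∀ {n} {X : Subset n} {u} → u ∈ X → mem X u ≡ true
∈⇒mem = []=⇒lookup

mem⇒∈ : ∀ {n} {X : Subset n} {u} → mem X u ≡ true → u ∈ X
mem⇒∈ {X = X} {u} = lookup⇒[]= u X

∉⇒mem : ∀ {n} {X : Subset n} {u} → u ∉ X → mem X u ≡ false
∉⇒mem {X = X} {u} u∉X with mem X u in e
... | true  = ⊥-elim (u∉X (mem⇒∈ e))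
... | false = refl

mem-false⇒∉ : ∀ {n} {X : Subset n} {u} → mem X u ≡ false → u ∉ X
mem-false⇒∉ h u∈X with () ← trans (sym (∈⇒mem u∈X)) h

mem-∪ : ∀ {n} (X Y : Subset n) u → mem (X ∪ Y) u ≡ mem X u ∨ mem Y u
mem-∪ X Y u = lookup-zipWith _∨_ u X Y

mem-∩ : ∀ {n} (X Y : Subset n) u → mem (X ∩ Y) u ≡ mem X u ∧ mem Y u
mem-∩ X Y u = lookup-zipWith _∧_ u X Y

mem-⊤ : ∀ {n} (u : Fin n) → mem ⊤ u ≡ true
mem-⊤ u = lookup-replicate u true

ΣF-cong : ∀ {n} {f g : Fin n → ℕ} → (∀ i → f i ≡ g i) → ΣF f ≡ ΣF g
ΣF-cong {zero}  h = refl
ΣF-cong {suc n} h = cong₂ _+_ (h F.zero) (ΣF-cong (λ i → h (F.suc i)))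

ΣF-mono : ∀ {n} {f g : Fin n → ℕ} → (∀ i → f i ≤ g i) → ΣF f ≤ ΣF g
ΣF-mono {zero}  h = z≤n
ΣF-mono {suc n} h = +-mono-≤ (h F.zero) (ΣF-mono (λ i → h (F.suc i)))

ΣF-zero : ∀ {n} {f : Fin n → ℕ} → (∀ i → f i ≡ 0) → ΣF f ≡ 0
ΣF-zero {zero}  h = refl
ΣF-zero {suc n} h = cong₂ _+_ (h F.zero) (ΣF-zero (λ i → h (F.suc i)))

ΣF-+ : ∀ {n} (f g : Fin n → ℕ) → ΣF (λ i → f i + g i) ≡ ΣF f + ΣF g
ΣF-+ {zero}  f g = refl
ΣF-+ {suc n} f g =
  trans (cong (f F.zero + g F.zero +_) (ΣF-+ (λ i → f (F.suc i)) (λ i → g (F.suc i))))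
        (interchange (f F.zero) (g F.zero) _ _)

ΣF-swap : ∀ {m n} (f : Fin m → Fin n → ℕ) →
          ΣF (λ i → ΣF (λ j → f i j)) ≡ ΣF (λ j → ΣF (λ i → f i j))
ΣF-swap {zero} {n} f = sym (ΣF-zero {n} (λ _ → refl))
ΣF-swap {suc m} f =
  trans (cong (ΣF (f F.zero) +_) (ΣF-swap (λ i → f (F.suc i))))
        (sym (ΣF-+ (f F.zero) (λ j → ΣF (λ i → f (F.suc i) j))))

ΣF-guard : ∀ {n} b (f : Fin n → ℕ) → [ b ]· (ΣF f) ≡ ΣF (λ i → [ b ]· (f i))
ΣF-guard true  f = refl
ΣF-guard {n} false f = sym (ΣF-zero {n} (λ _ → refl))

ΣF-single : ∀ {n} (p : Fin n → Bool) (f : Fin n → ℕ) c → p c ≡ true →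
            (∀ u → p u ≡ true → u ≡ c) → ΣF (λ u → [ p u ]· (f u)) ≡ f c
ΣF-single {suc n} p f F.zero pc only rewrite pc =
  trans (cong (f F.zero +_) (ΣF-zero off)) (+-identityʳ _)
  where
  off : ∀ i → [ p (F.suc i) ]· (f (F.suc i)) ≡ 0
  off i with p (F.suc i) in e
  ... | true with () ← only (F.suc i) e
  ... | false = refl
ΣF-single {suc n} p f (F.suc c) pc only with p F.zero in e
... | true with () ← only F.zero e
... | false = ΣF-single (λ i → p (F.suc i)) (λ i → f (F.suc i)) c pc
                        (λ u pu → FP.suc-injective (only (F.suc u) pu))

ΣΣ : ∀ {n} → (Fin n → Fin n → ℕ) → ℕ
ΣΣ f = ΣF λ u → ΣF λ v → f u v

ΣΣ-+ : ∀ {n} (f g : Fin n → Fin n → ℕ) → ΣΣ (λ u v → f u v + g u v) ≡ ΣΣ f + ΣΣ g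
ΣΣ-+ f g = trans (ΣF-cong (λ u → ΣF-+ (f u) (g u))) (ΣF-+ (λ u → ΣF (f u)) (λ u → ΣF (g u)))

-- f u v + f v u : the total contribution of the pair {u, v} to ΣΣ f.
Sym : ∀ {n} → (Fin n → Fin n → ℕ) → Fin n → Fin n → ℕ
Sym f u v = f u v + f v u

ΣΣ-double : ∀ {n} (f : Fin n → Fin n → ℕ) → ΣΣ f + ΣΣ f ≡ ΣΣ (Sym f)
ΣΣ-double f = trans (cong (ΣΣ f +_) (ΣF-swap f)) (sym (ΣΣ-+ f (λ u v → f v u)))

private
  half-≤ : ∀ {x y} → x + x ≤ y + y → x ≤ y
  half-≤ {x} {y} h with ≤-<-connex x y
  ... | inj₁ x≤y = x≤y
  ... | inj₂ y<x = ⊥-elim (<⇒≱ (+-mono-< y<x y<x) h)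

ΣΣ-by-pairs-≤ : ∀ {n} {f g : Fin n → Fin n → ℕ} → (∀ u → f u u ≤ g u u) →
                (∀ u v → u ≢ v → Sym f u v ≤ Sym g u v) → ΣΣ f ≤ ΣΣ g
ΣΣ-by-pairs-≤ {f = f} {g} diag off = half-≤ (begin
    ΣΣ f + ΣΣ f    ≡⟨ ΣΣ-double f ⟩
    ΣΣ (Sym f)     ≤⟨ ΣF-mono (λ u → ΣF-mono (pair u)) ⟩
    ΣΣ (Sym g)     ≡⟨ ΣΣ-double g ⟨
    ΣΣ g + ΣΣ g    ∎)
  where
  open ≤-Reasoning
  pair : ∀ u v → Sym f u v ≤ Sym g u v
  pair u v with u F.≟ v
  ... | yes refl = +-mono-≤ (diag u) (diag u)
  ... | no u≢v   = off u v u≢v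

ΣΣ-by-pairs-≡ : ∀ {n} {f g : Fin n → Fin n → ℕ} → (∀ u → f u u ≡ g u u) →
                (∀ u v → u ≢ v → Sym f u v ≡ Sym g u v) → ΣΣ f ≡ ΣΣ g
ΣΣ-by-pairs-≡ diag off =
  ≤-antisym (ΣΣ-by-pairs-≤ (λ u → ≤-reflexive (diag u)) (λ u v ne → ≤-reflexive (off u v ne)))
            (ΣΣ-by-pairs-≤ (λ u → ≤-reflexive (sym (diag u))) (λ u v ne → ≤-reflexive (sym (off u v ne))))

Sym-+ : ∀ {n} (f g : Fin n → Fin n → ℕ) u v →
        Sym (λ u v → f u v + g u v) u v ≡ Sym f u v + Sym g u v
Sym-+ f g u v = interchange (f u v) (g u v) (f v u) (g v u)

∧-true : ∀ {x y} → x ∧ y ≡ true → x ≡ true × y ≡ true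
∧-true {true} {true} _ = refl , refl

∧-intro : ∀ {x y} → x ≡ true → y ≡ true → x ∧ y ≡ true
∧-intro refl refl = refl

⇒-elim : ∀ {b c} → not b ∨ c ≡ true → b ≡ true → c ≡ true
⇒-elim {true} h refl = h

⇒-intro : ∀ {b c} → (b ≡ true → c ≡ true) → not b ∨ c ≡ true
⇒-intro {true}  h = h refl
⇒-intro {false} h = refl

allF-elim : ∀ {n} (f : Fin n → Bool) → allF f ≡ true → ∀ i → f i ≡ true
allF-elim {suc n} f h F.zero    = proj₁ (∧-true {f F.zero} h)
allF-elim {suc n} f h (F.suc i) = allF-elim (λ i → f (F.suc i)) (proj₂ (∧-true {f F.zero} h)) i

allF-intro : ∀ {n} (f : Fin n → Bool) → (∀ i → f i ≡ true) → allF f ≡ true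
allF-intro {zero}  f h = refl
allF-intro {suc n} f h = ∧-intro (h F.zero) (allF-intro (λ i → f (F.suc i)) (λ i → h (F.suc i)))

≟-false : ∀ {n} {u v : Fin n} → u ≢ v → ⌊ u F.≟ v ⌋ ≡ false
≟-false {u = u} {v} u≢v with u F.≟ v
... | yes u≡v = ⊥-elim (u≢v u≡v)
... | no  _   = refl

≟-true⇒≢ : ∀ {n} {u v : Fin n} → not ⌊ u F.≟ v ⌋ ≡ true → u ≢ v
≟-true⇒≢ {u = u} {v} h with u F.≟ v
... | no u≢v = u≢v

Anti : ∀ {n} → Trigraph n → Fin n → Fin n → Set
Anti G u v = antiᵇ (θ G u v) ≡ true

Stable : ∀ {n} → Trigraph n → Subset n → Subset n → Set
Stable G X S = S ⊆ X × (∀ {u v} → u ∈ S → v ∈ S → u ≢ v → Anti G u v)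

module _ {n} (G : Trigraph n) (X S : Subset n) where
  private
    inside? : Fin n → Bool
    inside? u = not (mem S u) ∨ mem X u
    pairOK? : Fin n → Fin n → Bool
    pairOK? u v = not (mem S u ∧ mem S v ∧ not ⌊ u F.≟ v ⌋) ∨ antiᵇ (θ G u v)

  stableᵇ-sound : stableᵇ G X S ≡ true → Stable G X S
  stableᵇ-sound h = inside , pairwise
    where
    inside : S ⊆ X
    inside u∈S = mem⇒∈ (⇒-elim (allF-elim inside? (proj₁ (∧-true h)) _) (∈⇒mem u∈S))
    pairwise : ∀ {u v} → u ∈ S → v ∈ S → u ≢ v → Anti G u v
    pairwise {u} {v} u∈S v∈S u≢v =
      ⇒-elim (allF-elim (pairOK? u) (allF-elim (λ u → allF (pairOK? u)) (proj₂ (∧-true {allF inside?} h)) u) v)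
             (∧-intro (∈⇒mem u∈S) (∧-intro (∈⇒mem v∈S) (cong not (≟-false u≢v))))

  stableᵇ-complete : Stable G X S → stableᵇ G X S ≡ true
  stableᵇ-complete (inside , pairwise) =
    ∧-intro (allF-intro inside? (λ u → ⇒-intro (λ su → ∈⇒mem (inside (mem⇒∈ su)))))
            (allF-intro (λ u → allF (pairOK? u)) (λ u → allF-intro (pairOK? u) (λ v → ⇒-intro (λ h →
              let (su , h′) = ∧-true {mem S u} h
                  (sv , ne) = ∧-true {mem S v} h′
              in pairwise (mem⇒∈ su) (mem⇒∈ sv) (≟-true⇒≢ ne)))))

Stable-⊆ : ∀ {n} {G : Trigraph n} {X X′ S S′ : Subset n} →
           Stable G X S → S′ ⊆ S → S′ ⊆ X′ → Stable G X′ S′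
Stable-⊆ (_ , pairwise) S′⊆S S′⊆X′ = S′⊆X′ , λ u∈ v∈ → pairwise (S′⊆S u∈) (S′⊆S v∈)

Stable-⊥ : ∀ {n} {G : Trigraph n} {X : Subset n} → Stable G X ⊥
Stable-⊥ {X = X} = ⊆-min X , λ u∈⊥ → ⊥-elim (∉⊥ u∈⊥)

record IsMaxStable {n} (G : Trigraph n) (R X : Subset n) (w : Weights n) (m : ℕ) : Set where
  field
    bound    : ∀ T → Stable G R T → wt X w T ≤ m
    attained : Σ (Subset n) λ T → Stable G R T × m ≤ wt X w T
open IsMaxStable public

IsMaxStable-unique : ∀ {n} {G : Trigraph n} {R X w m m′} →
  IsMaxStable G R X w m → IsMaxStable G R X w m′ → m ≡ m′
IsMaxStable-unique M M′ = ≤-antisym (below M M′) (below M′ M)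
  where
  below : ∀ {m m′} → IsMaxStable _ _ _ _ m → IsMaxStable _ _ _ _ m′ → m ≤ m′
  below M M′ = let (T , st , m≤) = attained M in ≤-trans m≤ (bound M′ T st)

IsMaxStable-mono : ∀ {n} {G : Trigraph n} {R R′ X w m m′} → R ⊆ R′ →
  IsMaxStable G R X w m → IsMaxStable G R′ X w m′ → m ≤ m′
IsMaxStable-mono R⊆R′ M M′ =
  let (T , (T⊆R , pairwise) , m≤) = attained M
  in ≤-trans m≤ (bound M′ T ((λ u∈T → R⊆R′ (T⊆R u∈T)) , pairwise))

maxSub-bound : ∀ {n} (f : Subset n → ℕ) S → f S ≤ maxSub f
maxSub-bound {zero}  f []          = ≤-refl
maxSub-bound {suc n} f (true ∷ S)  = ≤-trans (maxSub-bound (λ S → f (true ∷ S)) S) (m≤m⊔n _ _)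
maxSub-bound {suc n} f (false ∷ S) = ≤-trans (maxSub-bound (λ S → f (false ∷ S)) S) (m≤n⊔m _ _)

maxSub-attained : ∀ {n} (f : Subset n → ℕ) → Σ (Subset n) λ S → maxSub f ≡ f S
maxSub-attained {zero}  f = [] , refl
maxSub-attained {suc n} f with ≤-total (maxSub (λ S → f (true ∷ S))) (maxSub (λ S → f (false ∷ S)))
... | inj₁ t≤f = let (S , e) = maxSub-attained (λ S → f (false ∷ S)) in false ∷ S , trans (m≤n⇒m⊔n≡n t≤f) e
... | inj₂ f≤t = let (S , e) = maxSub-attained (λ S → f (true ∷ S))  in true ∷ S  , trans (m≥n⇒m⊔n≡m f≤t) e

α-isMax : ∀ {n} (G : Trigraph n) X w → IsMaxStable G X X w (α G X w)
α-isMax G X w = record { bound = bound′ ; attained = attained′ (maxSub-attained score) }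
  where
  score : Subset _ → ℕ
  score S = if stableᵇ G X S then wt X w S else 0
  bound′ : ∀ T → Stable G X T → wt X w T ≤ α G X w
  bound′ T st = subst (λ b → (if b then wt X w T else 0) ≤ α G X w)
                      (stableᵇ-complete G X T st) (maxSub-bound score T)
  attained′ : (Σ (Subset _) λ S → α G X w ≡ score S) → Σ (Subset _) λ T → Stable G X T × α G X w ≤ wt X w T
  attained′ (S , e) with stableᵇ G X S in st
  ... | true  = S , stableᵇ-sound G X S st , ≤-reflexive e
  ... | false = ⊥ , Stable-⊥ {G = G} , subst (_≤ wt X w ⊥) (sym e) z≤n

-- The weight that a pair {u, v} of distinct vertices contributes to
-- wt_X(S), given xu = [u ∈ X], su = [u ∈ S] (and likewise for v):
-- w(u,v) if u ∈ S and v ∈ X∖S, w(v,u) if v ∈ S and u ∈ X∖S,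
-- w(uv) if both lie in X∖S, and nothing otherwise.
pairWt : (xu su xv sv : Bool) (o o′ k : ℕ) → ℕ
pairWt xu su xv sv o o′ k =
  if su then (if sv then 0 else [ xv ]· o)
        else (if sv then [ xu ]· o′ else [ xu ∧ xv ]· k)

module _ {n : ℕ} where

  vertexWt : Subset n → (Fin n → ℕ) → ℕ
  vertexWt S f = ΣF λ u → [ mem S u ]· (f u)

  PW : Subset n → Weights n → Subset n → Fin n → Fin n → ℕ
  PW X w S u v =
      [ mem S u ∧ mem X v ∧ not (mem S v) ]· (wo w u v)
    + (if toℕ u <ᵇ toℕ v then [ mem X u ∧ not (mem S u) ∧ mem X v ∧ not (mem S v) ]· (wu w u v) else 0)

  pairPart : Subset n → Weights n → Subset n → ℕ
  pairPart X w S = ΣΣ (PW X w S)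

  wt-split : ∀ X w S → wt X w S ≡ vertexWt S (wv w) + pairPart X w S
  wt-split X w S =
    trans (+-assoc (vertexWt S (wv w)) _ _)
          (cong (vertexWt S (wv w) +_) (sym (ΣΣ-+ ordered unordered)))
    where
    ordered unordered : Fin n → Fin n → ℕ
    ordered u v = [ mem S u ∧ mem X v ∧ not (mem S v) ]· (wo w u v)
    unordered u v = if toℕ u <ᵇ toℕ v then [ mem X u ∧ not (mem S u) ∧ mem X v ∧ not (mem S v) ]· (wu w u v) else 0

  unorderedOnly : Weights n → Weights n
  unorderedOnly w = record w { wo = wu w }

  Ext-pairPart : ∀ Y R w → Ext Y R w ≡ pairPart Y (unorderedOnly w) R
  Ext-pairPart Y R w = trans (+-comm (ΣΣ unordered) (ΣΣ ordered)) (sym (ΣΣ-+ ordered unordered))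
    where
    ordered unordered : Fin n → Fin n → ℕ
    ordered u v = [ mem R u ∧ mem Y v ∧ not (mem R v) ]· (wu w u v)
    unordered u v = if toℕ u <ᵇ toℕ v then [ mem Y u ∧ not (mem R u) ∧ mem Y v ∧ not (mem R v) ]· (wu w u v) else 0

private
  <ᵇ-irrefl : ∀ m → (m <ᵇ m) ≡ false
  <ᵇ-irrefl zero    = refl
  <ᵇ-irrefl (suc m) = <ᵇ-irrefl m

  <ᵇ-trichotomy : ∀ m n → m ≢ n →
    ((m <ᵇ n) ≡ true × (n <ᵇ m) ≡ false) ⊎ ((m <ᵇ n) ≡ false × (n <ᵇ m) ≡ true)
  <ᵇ-trichotomy zero    zero    m≢n = ⊥-elim (m≢n refl)
  <ᵇ-trichotomy zero    (suc n) _   = inj₁ (refl , refl)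
  <ᵇ-trichotomy (suc m) zero    _   = inj₂ (refl , refl)
  <ᵇ-trichotomy (suc m) (suc n) m≢n = <ᵇ-trichotomy m n (λ e → m≢n (cong suc e))

  bracket≡pairWt : ∀ xu su xv sv o o′ k →
      ([ su ∧ xv ∧ not sv ]· o + [ sv ∧ xu ∧ not su ]· o′) + [ xu ∧ not su ∧ xv ∧ not sv ]· k
    ≡ pairWt xu su xv sv o o′ k
  bracket≡pairWt true  true  true  true  o o′ k = refl
  bracket≡pairWt true  true  true  false o o′ k = trans (+-identityʳ _) (+-identityʳ o)
  bracket≡pairWt true  true  false true  o o′ k = refl
  bracket≡pairWt true  true  false false o o′ k = refl
  bracket≡pairWt true  false true  true  o o′ k = +-identityʳ o′
  bracket≡pairWt true  false true  false o o′ k = refl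
  bracket≡pairWt true  false false true  o o′ k = +-identityʳ o′
  bracket≡pairWt true  false false false o o′ k = refl
  bracket≡pairWt false true  true  true  o o′ k = refl
  bracket≡pairWt false true  true  false o o′ k = trans (+-identityʳ _) (+-identityʳ o)
  bracket≡pairWt false true  false true  o o′ k = refl
  bracket≡pairWt false true  false false o o′ k = refl
  bracket≡pairWt false false true  true  o o′ k = refl
  bracket≡pairWt false false true  false o o′ k = refl
  bracket≡pairWt false false false true  o o′ k = refl
  bracket≡pairWt false false false false o o′ k = refl

  ∧-swap : ∀ a b c d → a ∧ b ∧ c ∧ d ≡ c ∧ d ∧ a ∧ b
  ∧-swap a b c d = trans (sym (∧-assoc a b (c ∧ d)))
                         (trans (∧-comm (a ∧ b) (c ∧ d)) (∧-assoc c d (a ∧ b)))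

module _ {n : ℕ} (X : Subset n) (w : Weights n) (S : Subset n) where

  PW-diag : ∀ u → PW X w S u u ≡ 0
  PW-diag u rewrite <ᵇ-irrefl (toℕ u) with mem S u | mem X u
  ... | true  | true  = refl
  ... | true  | false = refl
  ... | false | _     = refl

  PW-pair : ∀ u v → u ≢ v →
    Sym (PW X w S) u v ≡ pairWt (mem X u) (mem S u) (mem X v) (mem S v) (wo w u v) (wo w v u) (wu w u v)
  PW-pair u v u≢v = trans regroup (bracket≡pairWt (mem X u) (mem S u) (mem X v) (mem S v) _ _ _)
    where
    p q K K′ : ℕ
    p  = [ mem S u ∧ mem X v ∧ not (mem S v) ]· (wo w u v)
    q  = [ mem S v ∧ mem X u ∧ not (mem S u) ]· (wo w v u)
    K  = [ mem X u ∧ not (mem S u) ∧ mem X v ∧ not (mem S v) ]· (wu w u v)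
    K′ = [ mem X v ∧ not (mem S v) ∧ mem X u ∧ not (mem S u) ]· (wu w v u)
    K′≡K : K′ ≡ K
    K′≡K = cong₂ (λ b k → [ b ]· k) (∧-swap (mem X v) (not (mem S v)) (mem X u) (not (mem S u))) (wu-sym w v u)
    regroup : Sym (PW X w S) u v ≡ (p + q) + K
    regroup with <ᵇ-trichotomy (toℕ u) (toℕ v) (λ e → u≢v (FP.toℕ-injective e))
    ... | inj₁ (lt , gt) rewrite lt | gt =
      trans (cong ((p + K) +_) (+-identityʳ q)) (xy∙z≈xz∙y p K q)
    ... | inj₂ (lt , gt) rewrite lt | gt =
      trans (cong (_+ (q + K′)) (+-identityʳ p)) (trans (sym (+-assoc p q K′)) (cong ((p + q) +_) K′≡K))

module _ {n : ℕ} where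

  vertexWt-cong : ∀ {S : Subset n} {f g : Fin n → ℕ} → (∀ u → u ∈ S → f u ≡ g u) → vertexWt S f ≡ vertexWt S g
  vertexWt-cong {S} {f} {g} f≗g = ΣF-cong pointwise
    where
    pointwise : ∀ u → [ mem S u ]· (f u) ≡ [ mem S u ]· (g u)
    pointwise u with mem S u in su
    ... | true  = f≗g u (mem⇒∈ su)
    ... | false = refl

  vertexWt-empty : ∀ {S : Subset n} (f : Fin n → ℕ) → (∀ u → u ∉ S) → vertexWt S f ≡ 0
  vertexWt-empty {S} f empty = ΣF-zero (λ u → cong (λ b → [ b ]· (f u)) (∉⇒mem (empty u)))

  vertexWt-single : ∀ {S : Subset n} (f : Fin n → ℕ) {c} → c ∈ S → (∀ u → u ∈ S → u ≡ c) → vertexWt S f ≡ f c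
  vertexWt-single {S} f c∈S only = ΣF-single (mem S) f _ (∈⇒mem c∈S) (λ u su → only u (mem⇒∈ su))

  vertexWt-swap : ∀ {S : Subset n} {f g : Fin n → ℕ} {c} → c ∈ S → (∀ u → u ∈ S → u ≢ c → f u ≡ g u) →
                  vertexWt S f + g c ≡ vertexWt S g + f c
  vertexWt-swap {S} {f} {g} {c} c∈S f≗g = begin
    vertexWt S f + g c                  ≡⟨ cong (vertexWt S f +_) (vertexWt-single g (x∈⁅x⁆ c) (λ u → x∈⁅y⁆⇒x≡y c)) ⟨
    vertexWt S f + vertexWt ⁅ c ⁆ g     ≡⟨ ΣF-+ (λ u → [ mem S u ]· (f u)) (λ u → [ mem ⁅ c ⁆ u ]· (g u)) ⟨
    ΣF (λ u → [ mem S u ]· (f u) + [ mem ⁅ c ⁆ u ]· (g u)) ≡⟨ ΣF-cong pointwise ⟩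
    ΣF (λ u → [ mem S u ]· (g u) + [ mem ⁅ c ⁆ u ]· (f u)) ≡⟨ ΣF-+ (λ u → [ mem S u ]· (g u)) (λ u → [ mem ⁅ c ⁆ u ]· (f u)) ⟩
    vertexWt S g + vertexWt ⁅ c ⁆ f     ≡⟨ cong (vertexWt S g +_) (vertexWt-single f (x∈⁅x⁆ c) (λ u → x∈⁅y⁆⇒x≡y c)) ⟩
    vertexWt S g + f c                  ∎
    where
    open ≡-Reasoning
    pointwise : ∀ u → [ mem S u ]· (f u) + [ mem ⁅ c ⁆ u ]· (g u) ≡ [ mem S u ]· (g u) + [ mem ⁅ c ⁆ u ]· (f u)
    pointwise u with u F.≟ c
    ... | yes refl rewrite ∈⇒mem c∈S | ∈⇒mem (x∈⁅x⁆ c) = +-comm (f c) (g c)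
    ... | no u≢c rewrite ∉⇒mem (x≢y⇒x∉⁅y⁆ u≢c) with mem S u in su
    ...   | true  = cong (_+ 0) (f≗g u (mem⇒∈ su) u≢c)
    ...   | false = refl

data Nested : Bool → Bool → Bool → Set where
  inner   : Nested true  true  true
  middle  : Nested false true  true
  outer   : Nested false false true
  outside : Nested false false false

⊆-mem : ∀ {n} {P Q : Subset n} {u} → P ⊆ Q → mem P u ≡ true → mem Q u ≡ true
⊆-mem P⊆Q pu = ∈⇒mem (P⊆Q (mem⇒∈ pu))

nested : ∀ {n} {P Q Z : Subset n} → P ⊆ Q → Q ⊆ Z → ∀ u → Nested (mem P u) (mem Q u) (mem Z u)
nested {P = P} {Q} {Z} P⊆Q Q⊆Z u with mem P u in p | mem Q u in q | mem Z u in z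
... | true  | true  | true  = inner
... | false | true  | true  = middle
... | false | false | true  = outer
... | false | false | false = outside
... | true  | false | _     with () ← trans (sym (⊆-mem P⊆Q p)) q
... | _     | true  | false with () ← trans (sym (⊆-mem Q⊆Z q)) z

-- Pair-level form of the Red/Ext identity, for T ⊆ R ⊆ Y
-- (memberships p = [· ∈ T], q = [· ∈ R], z = [· ∈ Y]): the pair weight in
-- wt_R(T) plus the pair's share of Ext equals its pair weight in wt_Y(T)
-- plus the amounts w(uv) − w(u,v) that Red subtracts from T-vertices.
pairWt-red : ∀ {pu qu zu pv qv zv} → Nested pu qu zu → Nested pv qv zv →
  ∀ {o o′ k} → o ≤ k → o′ ≤ k →
    pairWt qu pu qv pv o o′ k + pairWt zu qu zv qv k k k
  ≡ pairWt zu pu zv pv o o′ k + ([ pu ]· ([ zv ∧ not qv ]· (k ∸ o)) + [ pv ]· ([ zu ∧ not qu ]· (k ∸ o′)))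
pairWt-red inner   inner   o≤k o′≤k = refl
pairWt-red inner   middle  o≤k o′≤k = refl
pairWt-red inner   outer   {o} {k = k} o≤k o′≤k = sym (trans (cong (o +_) (+-identityʳ (k ∸ o))) (m+[n∸m]≡n o≤k))
pairWt-red inner   outside o≤k o′≤k = refl
pairWt-red middle  inner   o≤k o′≤k = refl
pairWt-red middle  middle  o≤k o′≤k = refl
pairWt-red middle  outer   {k = k} o≤k o′≤k = sym (+-identityʳ k)
pairWt-red middle  outside o≤k o′≤k = refl
pairWt-red outer   inner   o≤k o′≤k = sym (m+[n∸m]≡n o′≤k)
pairWt-red outer   middle  {k = k} o≤k o′≤k = sym (+-identityʳ k)
pairWt-red outer   outer   {k = k} o≤k o′≤k = sym (+-identityʳ k)
pairWt-red outer   outside o≤k o′≤k = refl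
pairWt-red outside inner   o≤k o′≤k = refl
pairWt-red outside middle  o≤k o′≤k = refl
pairWt-red outside outer   o≤k o′≤k = refl
pairWt-red outside outside o≤k o′≤k = refl

-- Pair-level monotonicity: shrinking a set from Q to P ⊆ Q inside Z never
-- decreases the weight of a pair, because w(u,v) ≤ w(uv).
pairWt-shrink : ∀ {pu qu zu pv qv zv} → Nested pu qu zu → Nested pv qv zv →
  ∀ {o o′ k} → o ≤ k → o′ ≤ k → pairWt zu qu zv qv o o′ k ≤ pairWt zu pu zv pv o o′ k
pairWt-shrink inner   inner   o≤k o′≤k = z≤n
pairWt-shrink inner   middle  o≤k o′≤k = z≤n
pairWt-shrink inner   outer   o≤k o′≤k = ≤-refl
pairWt-shrink inner   outside o≤k o′≤k = z≤n
pairWt-shrink middle  inner   o≤k o′≤k = z≤n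
pairWt-shrink middle  middle  o≤k o′≤k = z≤n
pairWt-shrink middle  outer   o≤k o′≤k = o≤k
pairWt-shrink middle  outside o≤k o′≤k = z≤n
pairWt-shrink outer   inner   o≤k o′≤k = ≤-refl
pairWt-shrink outer   middle  o≤k o′≤k = o′≤k
pairWt-shrink outer   outer   o≤k o′≤k = ≤-refl
pairWt-shrink outer   outside o≤k o′≤k = z≤n
pairWt-shrink outside inner   o≤k o′≤k = z≤n
pairWt-shrink outside middle  o≤k o′≤k = z≤n
pairWt-shrink outside outer   o≤k o′≤k = z≤n
pairWt-shrink outside outside o≤k o′≤k = z≤n

-- The consequence of being a weight function used throughout: w(u,v) ≤ w(uv).
PairBounded : ∀ {n} → Weights n → Set
PairBounded w = ∀ u v → u ≢ v → wo w u v ≤ wu w u v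

module _ {n} (w : Weights n) (bounded : PairBounded w) where

  bounded-flip : ∀ u v → u ≢ v → wo w v u ≤ wu w u v
  bounded-flip u v u≢v = subst (wo w v u ≤_) (wu-sym w v u) (bounded v u (λ e → u≢v (sym e)))

  pairPart-shrink : ∀ {X T T₀ : Subset n} → T ⊆ T₀ → T₀ ⊆ X → pairPart X w T₀ ≤ pairPart X w T
  pairPart-shrink {X} {T} {T₀} T⊆T₀ T₀⊆X = ΣΣ-by-pairs-≤ diag off
    where
    diag : ∀ u → PW X w T₀ u u ≤ PW X w T u u
    diag u = ≤-reflexive (trans (PW-diag X w T₀ u) (sym (PW-diag X w T u)))
    off : ∀ u v → u ≢ v → Sym (PW X w T₀) u v ≤ Sym (PW X w T) u v
    off u v u≢v = begin
      Sym (PW X w T₀) u v ≡⟨ PW-pair X w T₀ u v u≢v ⟩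
      pairWt (mem X u) (mem T₀ u) (mem X v) (mem T₀ v) (wo w u v) (wo w v u) (wu w u v)
        ≤⟨ pairWt-shrink (nested T⊆T₀ T₀⊆X u) (nested T⊆T₀ T₀⊆X v) (bounded u v u≢v) (bounded-flip u v u≢v) ⟩
      pairWt (mem X u) (mem T u) (mem X v) (mem T v) (wo w u v) (wo w v u) (wu w u v) ≡⟨ PW-pair X w T u v u≢v ⟨
      Sym (PW X w T) u v ∎
      where open ≤-Reasoning

  wt-drop : ∀ {X T T₀ : Subset n} → T ⊆ T₀ → T₀ ⊆ X →
    (∀ u → u ∈ T₀ → u ∉ T → wv w u ≡ 0) → wt X w T₀ ≤ wt X w T
  wt-drop {X} {T} {T₀} T⊆T₀ T₀⊆X weightless = begin
    wt X w T₀                                   ≡⟨ wt-split X w T₀ ⟩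
    vertexWt T₀ (wv w) + pairPart X w T₀         ≤⟨ +-mono-≤ (ΣF-mono vertex) (pairPart-shrink T⊆T₀ T₀⊆X) ⟩
    vertexWt T (wv w) + pairPart X w T           ≡⟨ wt-split X w T ⟨
    wt X w T                                    ∎
    where
    open ≤-Reasoning
    guard-shrink : ∀ {p q z} → Nested p q z → ∀ x → (q ≡ true → p ≡ false → x ≡ 0) → [ q ]· x ≤ [ p ]· x
    guard-shrink inner   x _ = ≤-refl
    guard-shrink middle  x h = ≤-reflexive (h refl refl)
    guard-shrink outer   x _ = z≤n
    guard-shrink outside x _ = z≤n
    vertex : ∀ u → [ mem T₀ u ]· (wv w u) ≤ [ mem T u ]· (wv w u)
    vertex u = guard-shrink (nested T⊆T₀ T₀⊆X u) (wv w u)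
                 (λ t₀ t → weightless u (mem⇒∈ t₀) (mem-false⇒∉ t))

-- The amount by which Red[G[Y],w;R] lowers the weight of u (before
-- truncation at 0): the sum of w(uv) − w(u,v) over v ∈ Y∖R.
redLoss : ∀ {n} → Subset n → Subset n → Weights n → Fin n → ℕ
redLoss Y R w u = ΣF (λ v → [ mem Y v ∧ not (mem R v) ]· (wu w u v ∸ wo w u v))

module _ {n} (w : Weights n) (bounded : PairBounded w) {Y R : Subset n} (R⊆Y : R ⊆ Y) where

  private
    loss : Subset n → Fin n → Fin n → ℕ
    loss T u v = [ mem T u ]· ([ mem Y v ∧ not (mem R v) ]· (wu w u v ∸ wo w u v))

    loss-total : ∀ T → vertexWt T (redLoss Y R w) ≡ ΣΣ (loss T)
    loss-total T = ΣF-cong (λ u → ΣF-guard (mem T u) (λ v → [ mem Y v ∧ not (mem R v) ]· (wu w u v ∸ wo w u v)))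

    loss-diag : ∀ {p q z} → Nested p q z → ∀ d → [ p ]· ([ z ∧ not q ]· d) ≡ 0
    loss-diag inner   d = refl
    loss-diag middle  d = refl
    loss-diag outer   d = refl
    loss-diag outside d = refl

  -- For T ⊆ R, passing from G[Y] to G[R] loses the pair weight between R and
  -- Y∖R; Ext pays it back, except for the part w(uv) − w(u,v) that Red
  -- already subtracts from the vertices of T.
  pairPart-red : ∀ {T} → T ⊆ R →
    pairPart R w T + Ext Y R w ≡ pairPart Y w T + vertexWt T (redLoss Y R w)
  pairPart-red {T} T⊆R = begin
    pairPart R w T + Ext Y R w                              ≡⟨ cong (pairPart R w T +_) (Ext-pairPart Y R w) ⟩
    ΣΣ (PW R w T) + ΣΣ (PW Y w⁺ R)                          ≡⟨ ΣΣ-+ (PW R w T) (PW Y w⁺ R) ⟨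
    ΣΣ (λ u v → PW R w T u v + PW Y w⁺ R u v)               ≡⟨ ΣΣ-by-pairs-≡ diag off ⟩
    ΣΣ (λ u v → PW Y w T u v + loss T u v)                  ≡⟨ ΣΣ-+ (PW Y w T) (loss T) ⟩
    pairPart Y w T + ΣΣ (loss T)                            ≡⟨ cong (pairPart Y w T +_) (loss-total T) ⟨
    pairPart Y w T + vertexWt T (redLoss Y R w)             ∎
    where
    open ≡-Reasoning
    w⁺ = unorderedOnly w
    chain = nested T⊆R R⊆Y
    diag : ∀ u → PW R w T u u + PW Y w⁺ R u u ≡ PW Y w T u u + loss T u u
    diag u rewrite PW-diag R w T u | PW-diag Y w⁺ R u | PW-diag Y w T u =
      sym (loss-diag (chain u) (wu w u u ∸ wo w u u))
    off : ∀ u v → u ≢ v →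
      Sym (λ u v → PW R w T u v + PW Y w⁺ R u v) u v ≡ Sym (λ u v → PW Y w T u v + loss T u v) u v
    off u v u≢v = begin
      Sym (λ u v → PW R w T u v + PW Y w⁺ R u v) u v      ≡⟨ Sym-+ (PW R w T) (PW Y w⁺ R) u v ⟩
      Sym (PW R w T) u v + Sym (PW Y w⁺ R) u v             ≡⟨ cong₂ _+_ (PW-pair R w T u v u≢v) (PW-pair Y w⁺ R u v u≢v) ⟩
      inR + ext (wu w v u)                                 ≡⟨ cong (λ x → inR + ext x) (wu-sym w v u) ⟩
      inR + ext k                                          ≡⟨ pairWt-red (chain u) (chain v) (bounded u v u≢v) (bounded-flip w bounded u v u≢v) ⟩
      inY + (loss T u v + lossOf k)                        ≡⟨ cong₂ _+_ (PW-pair Y w T u v u≢v) (cong (λ x → loss T u v + lossOf x) (wu-sym w v u)) ⟨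
      Sym (PW Y w T) u v + Sym (loss T) u v                ≡⟨ Sym-+ (PW Y w T) (loss T) u v ⟨
      Sym (λ u v → PW Y w T u v + loss T u v) u v          ∎
      where
      o o′ k inR inY : ℕ
      o = wo w u v
      o′ = wo w v u
      k = wu w u v
      inR = pairWt (mem R u) (mem T u) (mem R v) (mem T v) o o′ k
      inY = pairWt (mem Y u) (mem T u) (mem Y v) (mem T v) o o′ k
      ext lossOf : ℕ → ℕ
      ext k′ = pairWt (mem Y u) (mem R u) (mem Y v) (mem R v) k k′ k
      lossOf k′ = [ mem T v ]· ([ mem Y u ∧ not (mem R u) ]· (k′ ∸ o′))

  module _ (G : Trigraph n) where
    private
      red = redWeights Y R w
      l = redLoss Y R w

    wt-red : ∀ {T} → T ⊆ R →
      wt R red T + Ext Y R w ≡ (vertexWt T (wv red) + vertexWt T l) + pairPart Y w T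
    wt-red {T} T⊆R = begin
      wt R red T + Ext Y R w                                    ≡⟨ cong (_+ Ext Y R w) (wt-split R red T) ⟩
      (vertexWt T (wv red) + pairPart R w T) + Ext Y R w        ≡⟨ +-assoc (vertexWt T (wv red)) _ _ ⟩
      vertexWt T (wv red) + (pairPart R w T + Ext Y R w)        ≡⟨ cong (vertexWt T (wv red) +_) (pairPart-red T⊆R) ⟩
      vertexWt T (wv red) + (pairPart Y w T + vertexWt T l)     ≡⟨ x∙yz≈xz∙y (vertexWt T (wv red)) _ _ ⟩
      (vertexWt T (wv red) + vertexWt T l) + pairPart Y w T     ∎
      where open ≡-Reasoning

    red-isMax : IsMaxStable G R Y w (αRed G Y R w + Ext Y R w)
    red-isMax = record { bound = bound′ ; attained = attained′ (attained (α-isMax G R red)) }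
      where
      truncation : ∀ T → vertexWt T (wv w) ≤ vertexWt T (wv red) + vertexWt T l
      truncation T = subst (vertexWt T (wv w) ≤_) (ΣF-+ (λ u → [ mem T u ]· (wv red u)) (λ u → [ mem T u ]· (l u)))
                       (ΣF-mono (λ u → guarded (mem T u) (wv w u) (l u)))
        where
        guarded : ∀ b x y → [ b ]· x ≤ [ b ]· (x ∸ y) + [ b ]· y
        guarded true  x y = subst (x ≤_) (+-comm y (x ∸ y)) (m≤n+m∸n x y)
        guarded false x y = z≤n

      bound′ : ∀ T → Stable G R T → wt Y w T ≤ αRed G Y R w + Ext Y R w
      bound′ T st = begin
        wt Y w T                                                 ≡⟨ wt-split Y w T ⟩
        vertexWt T (wv w) + pairPart Y w T                       ≤⟨ +-monoˡ-≤ _ (truncation T) ⟩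
        (vertexWt T (wv red) + vertexWt T l) + pairPart Y w T    ≡⟨ wt-red (proj₁ st) ⟨
        wt R red T + Ext Y R w                                   ≤⟨ +-monoˡ-≤ _ (bound (α-isMax G R red) T st) ⟩
        αRed G Y R w + Ext Y R w                                 ∎
        where open ≤-Reasoning

      -- Vertices whose weight Red truncates to 0 may be dropped; on the
      -- remaining ones the truncation is exact.
      Keep : Subset n
      Keep = tabulate (λ u → ⌊ l u ≤? wv w u ⌋)

      attained′ : (Σ (Subset n) λ T₀ → Stable G R T₀ × α G R red ≤ wt R red T₀) →
                  Σ (Subset n) λ T → Stable G R T × αRed G Y R w + Ext Y R w ≤ wt Y w T
      attained′ (T₀ , st₀ , opt) = T′ , Stable-⊆ {G = G} {X = R} st₀ T′⊆T₀ (λ u∈ → proj₁ st₀ (T′⊆T₀ u∈)) , (begin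
        αRed G Y R w + Ext Y R w                                 ≤⟨ +-monoˡ-≤ _ opt ⟩
        wt R red T₀ + Ext Y R w                                  ≤⟨ +-monoˡ-≤ _ (wt-drop red bounded T′⊆T₀ (proj₁ st₀) dropped) ⟩
        wt R red T′ + Ext Y R w                                  ≡⟨ wt-red (λ u∈ → proj₁ st₀ (T′⊆T₀ u∈)) ⟩
        (vertexWt T′ (wv red) + vertexWt T′ l) + pairPart Y w T′ ≡⟨ cong (_+ pairPart Y w T′) exact ⟩
        vertexWt T′ (wv w) + pairPart Y w T′                     ≡⟨ wt-split Y w T′ ⟨
        wt Y w T′                                                ∎)
        where
        open ≤-Reasoning
        T′ = T₀ ∩ Keep
        T′⊆T₀ : T′ ⊆ T₀
        T′⊆T₀ = p∩q⊆p T₀ Keep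
        mem-T′ : ∀ u → mem T′ u ≡ mem T₀ u ∧ ⌊ l u ≤? wv w u ⌋
        mem-T′ u = trans (mem-∩ T₀ Keep u) (cong (mem T₀ u ∧_) (lookup∘tabulate _ u))
        dropped : ∀ u → u ∈ T₀ → u ∉ T′ → wv red u ≡ 0
        dropped u u∈T₀ u∉T′ with l u ≤? wv w u in kept
        ... | yes _  = ⊥-elim (u∉T′ (mem⇒∈ (trans (mem-T′ u) (cong₂ _∧_ (∈⇒mem u∈T₀) (cong ⌊_⌋ kept)))))
        ... | no l≰x = m≤n⇒m∸n≡0 (<⇒≤ (≰⇒> l≰x))
        exact : vertexWt T′ (wv red) + vertexWt T′ l ≡ vertexWt T′ (wv w)
        exact = trans (sym (ΣF-+ (λ u → [ mem T′ u ]· (wv red u)) (λ u → [ mem T′ u ]· (l u)))) (ΣF-cong pointwise)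
          where
          pointwise : ∀ u → [ mem T′ u ]· (wv red u) + [ mem T′ u ]· (l u) ≡ [ mem T′ u ]· (wv w u)
          pointwise u rewrite mem-T′ u with mem T₀ u | l u ≤? wv w u
          ... | true  | yes l≤x = m∸n+n≡m l≤x
          ... | true  | no  _   = refl
          ... | false | _       = refl

pairWt-restrict : ∀ xu su xv sv o o′ k →
  pairWt xu (su ∧ xu) xv (sv ∧ xv) o o′ k ≡ [ xu ∧ xv ]· (pairWt true su true sv o o′ k)
pairWt-restrict true  true  true  true  o o′ k = refl
pairWt-restrict true  true  true  false o o′ k = refl
pairWt-restrict true  true  false true  o o′ k = refl
pairWt-restrict true  true  false false o o′ k = refl
pairWt-restrict true  false true  true  o o′ k = refl
pairWt-restrict true  false true  false o o′ k = refl
pairWt-restrict true  false false true  o o′ k = refl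
pairWt-restrict true  false false false o o′ k = refl
pairWt-restrict false true  true  true  o o′ k = refl
pairWt-restrict false true  true  false o o′ k = refl
pairWt-restrict false true  false true  o o′ k = refl
pairWt-restrict false true  false false o o′ k = refl
pairWt-restrict false false true  true  o o′ k = refl
pairWt-restrict false false true  false o o′ k = refl
pairWt-restrict false false false true  o o′ k = refl
pairWt-restrict false false false false o o′ k = refl

pairWt-zero : ∀ su sv → pairWt true su true sv 0 0 0 ≡ 0
pairWt-zero true  true  = refl
pairWt-zero true  false = refl
pairWt-zero false true  = refl
pairWt-zero false false = refl

module CliqueCutsetSplit {n} (G : Trigraph n) (w : Weights n) (isWF : IsWeightFunction G w)
                         {A B C : Subset n} (clique : StrongClique G C) (cp : CutPartition G A B C) where
  open CutPartition cp

  XA XB : Subset n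
  XA = A ∪ C
  XB = B ∪ C

  bounded : PairBounded w
  bounded u v u≢v = proj₂ (isWF u v ∈⊤ ∈⊤ u≢v)

  data Side (u : Fin n) : Bool → Bool → Bool → Set where
    onA : u ∈ A → Side u true  false false
    onB : u ∈ B → Side u false true  false
    onC : u ∈ C → Side u true  true  true

  side : ∀ u → Side u (mem XA u) (mem XB u) (mem C u)
  side u rewrite mem-∪ A C u | mem-∪ B C u with cover u
  ... | inj₁ u∈A rewrite ∈⇒mem u∈A | ∉⇒mem (disjAB u u∈A) | ∉⇒mem (disjAC u u∈A) = onA u∈A
  ... | inj₂ (inj₁ u∈B) rewrite ∈⇒mem u∈B | ∉⇒mem (disjBC u u∈B) | ∉⇒mem (λ u∈A → disjAB u u∈A u∈B) = onB u∈B
  ... | inj₂ (inj₂ u∈C) rewrite ∈⇒mem u∈C | ∉⇒mem (λ u∈A → disjAC u u∈A u∈C) | ∉⇒mem (λ u∈B → disjBC u u∈B u∈C) = onC u∈C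

  pairWt-nonSemi : ∀ u v → u ≢ v → θ G u v ≢ semi → ∀ su sv →
    pairWt true su true sv (wo w u v) (wo w v u) (wu w u v) ≡ 0
  pairWt-nonSemi u v u≢v notSemi su sv
    with (o≡0 , o′≡0 , k≡0) ← proj₁ (isWF u v ∈⊤ ∈⊤ u≢v) notSemi
    rewrite o≡0 | o′≡0 | k≡0 = pairWt-zero su sv

  private
    anti≢semi : ∀ {u v} → θ G u v ≡ strongAnti → θ G u v ≢ semi
    anti≢semi e e′ with () ← trans (sym e) e′

    strong≢semi : ∀ {u v} → θ G u v ≡ strong → θ G u v ≢ semi
    strong≢semi e e′ with () ← trans (sym e) e′

  -- Every pair of distinct vertices lies inside G_A or inside G_B; a pair
  -- lying in both is inside C, and one lying in neither crosses from A to B,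
  -- and such pairs carry no weight.
  pairWt-split : ∀ {u v au bu cu av bv cv} → Side u au bu cu → Side v av bv cv → u ≢ v → ∀ su sv →
    let p = pairWt true su true sv (wo w u v) (wo w v u) (wu w u v)
    in [ au ∧ av ]· p + [ bu ∧ bv ]· p ≡ p
  pairWt-split (onA _) (onA _) u≢v su sv = +-identityʳ _
  pairWt-split (onA _) (onC _) u≢v su sv = +-identityʳ _
  pairWt-split (onC _) (onA _) u≢v su sv = +-identityʳ _
  pairWt-split (onB _) (onB _) u≢v su sv = refl
  pairWt-split (onB _) (onC _) u≢v su sv = refl
  pairWt-split (onC _) (onB _) u≢v su sv = refl
  pairWt-split {u} {v} (onA u∈A) (onB v∈B) u≢v su sv =
    sym (pairWt-nonSemi u v u≢v (anti≢semi (anti u v u∈A v∈B)) su sv)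
  pairWt-split {u} {v} (onB u∈B) (onA v∈A) u≢v su sv =
    sym (pairWt-nonSemi u v u≢v (anti≢semi (trans (θ-sym G u v) (anti v u v∈A u∈B))) su sv)
  pairWt-split {u} {v} (onC u∈C) (onC v∈C) u≢v su sv
    rewrite pairWt-nonSemi u v u≢v (strong≢semi (clique u v u∈C v∈C u≢v)) su sv = refl

  -- Each vertex of S is counted once in G_A or G_B, except that the vertices
  -- of S ∩ C are counted in both.
  vertex-split : ∀ {u a b c} → Side u a b c → ∀ s x → [ s ]· x + [ s ∧ c ]· x ≡ [ s ∧ a ]· x + [ s ∧ b ]· x
  vertex-split (onA _) true  x = refl
  vertex-split (onB _) true  x = +-identityʳ x
  vertex-split (onC _) true  x = refl
  vertex-split (onA _) false x = refl
  vertex-split (onB _) false x = refl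
  vertex-split (onC _) false x = refl

  vertexWt-decompose : ∀ S →
    vertexWt S (wv w) + vertexWt (S ∩ C) (wv w) ≡ vertexWt (S ∩ XA) (wv w) + vertexWt (S ∩ XB) (wv w)
  vertexWt-decompose S = trans (sym (ΣF-+ (guarded S) (guarded (S ∩ C))))
                               (trans (ΣF-cong pointwise) (ΣF-+ (guarded (S ∩ XA)) (guarded (S ∩ XB))))
    where
    guarded : Subset n → Fin n → ℕ
    guarded X u = [ mem X u ]· (wv w u)
    pointwise : ∀ u → [ mem S u ]· (wv w u) + [ mem (S ∩ C) u ]· (wv w u)
                    ≡ [ mem (S ∩ XA) u ]· (wv w u) + [ mem (S ∩ XB) u ]· (wv w u)
    pointwise u rewrite mem-∩ S C u | mem-∩ S XA u | mem-∩ S XB u = vertex-split (side u) (mem S u) (wv w u)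

  pairPart-decompose : ∀ S → pairPart ⊤ w S ≡ pairPart XA w (S ∩ XA) + pairPart XB w (S ∩ XB)
  pairPart-decompose S = trans (ΣΣ-by-pairs-≡ diag off) (ΣΣ-+ (PW XA w (S ∩ XA)) (PW XB w (S ∩ XB)))
    where
    open ≡-Reasoning
    diag : ∀ u → PW ⊤ w S u u ≡ PW XA w (S ∩ XA) u u + PW XB w (S ∩ XB) u u
    diag u rewrite PW-diag ⊤ w S u | PW-diag XA w (S ∩ XA) u | PW-diag XB w (S ∩ XB) u = refl
    off : ∀ u v → u ≢ v → Sym (PW ⊤ w S) u v ≡ Sym (λ u v → PW XA w (S ∩ XA) u v + PW XB w (S ∩ XB) u v) u v
    off u v u≢v = begin
      Sym (PW ⊤ w S) u v
        ≡⟨ PW-pair ⊤ w S u v u≢v ⟩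
      pairWt (mem ⊤ u) (mem S u) (mem ⊤ v) (mem S v) o o′ k
        ≡⟨ cong₂ (λ x y → pairWt x (mem S u) y (mem S v) o o′ k) (mem-⊤ u) (mem-⊤ v) ⟩
      p
        ≡⟨ pairWt-split (side u) (side v) u≢v (mem S u) (mem S v) ⟨
      [ mem XA u ∧ mem XA v ]· p + [ mem XB u ∧ mem XB v ]· p
        ≡⟨ cong₂ _+_ (pairWt-restrict (mem XA u) (mem S u) (mem XA v) (mem S v) o o′ k)
                     (pairWt-restrict (mem XB u) (mem S u) (mem XB v) (mem S v) o o′ k) ⟨
      pairWt (mem XA u) (mem S u ∧ mem XA u) (mem XA v) (mem S v ∧ mem XA v) o o′ k
        + pairWt (mem XB u) (mem S u ∧ mem XB u) (mem XB v) (mem S v ∧ mem XB v) o o′ k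
        ≡⟨ cong₂ _+_ (cong₂ (λ x y → pairWt (mem XA u) x (mem XA v) y o o′ k) (mem-∩ S XA u) (mem-∩ S XA v))
                     (cong₂ (λ x y → pairWt (mem XB u) x (mem XB v) y o o′ k) (mem-∩ S XB u) (mem-∩ S XB v)) ⟨
      pairWt (mem XA u) (mem (S ∩ XA) u) (mem XA v) (mem (S ∩ XA) v) o o′ k
        + pairWt (mem XB u) (mem (S ∩ XB) u) (mem XB v) (mem (S ∩ XB) v) o o′ k
        ≡⟨ cong₂ _+_ (PW-pair XA w (S ∩ XA) u v u≢v) (PW-pair XB w (S ∩ XB) u v u≢v) ⟨
      Sym (PW XA w (S ∩ XA)) u v + Sym (PW XB w (S ∩ XB)) u v
        ≡⟨ Sym-+ (PW XA w (S ∩ XA)) (PW XB w (S ∩ XB)) u v ⟨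
      Sym (λ u v → PW XA w (S ∩ XA) u v + PW XB w (S ∩ XB) u v) u v ∎
      where
      o o′ k p : ℕ
      o = wo w u v
      o′ = wo w v u
      k = wu w u v
      p = pairWt true (mem S u) true (mem S v) o o′ k

  decompose : ∀ S → wt ⊤ w S + vertexWt (S ∩ C) (wv w) ≡ wt XA w (S ∩ XA) + wt XB w (S ∩ XB)
  decompose S = begin
    wt ⊤ w S + vertexWt (S ∩ C) (wv w)
      ≡⟨ cong (_+ vertexWt (S ∩ C) (wv w)) (wt-split ⊤ w S) ⟩
    (vertexWt S (wv w) + pairPart ⊤ w S) + vertexWt (S ∩ C) (wv w)
      ≡⟨ xy∙z≈xz∙y (vertexWt S (wv w)) _ _ ⟩
    (vertexWt S (wv w) + vertexWt (S ∩ C) (wv w)) + pairPart ⊤ w S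
      ≡⟨ cong₂ _+_ (vertexWt-decompose S) (pairPart-decompose S) ⟩
    (vertexWt (S ∩ XA) (wv w) + vertexWt (S ∩ XB) (wv w)) + (pairPart XA w (S ∩ XA) + pairPart XB w (S ∩ XB))
      ≡⟨ interchange (vertexWt (S ∩ XA) (wv w)) _ _ _ ⟩
    (vertexWt (S ∩ XA) (wv w) + pairPart XA w (S ∩ XA)) + (vertexWt (S ∩ XB) (wv w) + pairPart XB w (S ∩ XB))
      ≡⟨ cong₂ _+_ (wt-split XA w (S ∩ XA)) (wt-split XB w (S ∩ XB)) ⟨
    wt XA w (S ∩ XA) + wt XB w (S ∩ XB) ∎
    where open ≡-Reasoning

  meetsC : ∀ {X S} → Stable G X S →
    (∀ u → u ∉ S ∩ C) ⊎ Σ (Fin n) λ c → c ∈ S ∩ C × (∀ u → u ∈ S ∩ C → u ≡ c)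
  meetsC {S = S} (_ , pairwise) with FP.any? (λ u → u ∈? (S ∩ C))
  ... | no none = inj₁ (λ u u∈ → none (u , u∈))
  ... | yes (c , c∈) = inj₂ (c , c∈ , only)
    where
    only : ∀ u → u ∈ S ∩ C → u ≡ c
    only u u∈ with u F.≟ c
    ... | yes u≡c = u≡c
    ... | no u≢c with () ← trans (sym (pairwise (proj₁ (x∈p∩q⁻ S C u∈)) (proj₁ (x∈p∩q⁻ S C c∈)) u≢c))
                                  (cong antiᵇ (clique u c (proj₂ (x∈p∩q⁻ S C u∈)) (proj₂ (x∈p∩q⁻ S C c∈)) u≢c))

  XA∩XB⊆C : ∀ {u} → u ∈ XA → u ∈ XB → u ∈ C
  XA∩XB⊆C {u} u∈XA u∈XB with x∈p∪q⁻ A C u∈XA | x∈p∪q⁻ B C u∈XB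
  ... | inj₂ u∈C | _        = u∈C
  ... | inj₁ _   | inj₂ u∈C = u∈C
  ... | inj₁ u∈A | inj₁ u∈B = ⊥-elim (disjAB u u∈A u∈B)

  XA-C⊆A : ∀ {u} → u ∈ XA → u ∉ C → u ∈ A
  XA-C⊆A {u} u∈XA u∉C with x∈p∪q⁻ A C u∈XA
  ... | inj₁ u∈A = u∈A
  ... | inj₂ u∈C = ⊥-elim (u∉C u∈C)

  XB-C⊆B : ∀ {u} → u ∈ XB → u ∉ C → u ∈ B
  XB-C⊆B {u} u∈XB u∉C with x∈p∪q⁻ B C u∈XB
  ... | inj₁ u∈B = u∈B
  ... | inj₂ u∈C = ⊥-elim (u∉C u∈C)

  glue : ∀ {T U} → Stable G XA T → Stable G XB U →
         (∀ {u} → u ∈ C → u ∈ T → u ∈ U) → (∀ {u} → u ∈ C → u ∈ U → u ∈ T) →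
         Stable G ⊤ (T ∪ U) × (T ∪ U) ∩ XA ≡ T × (T ∪ U) ∩ XB ≡ U
  glue {T} {U} (T⊆XA , stT) (U⊆XB , stU) T→U U→T = (⊆⊤ , pairwise) , traceA , traceB
    where
    cross : ∀ {u v} → u ∈ T → v ∈ U → u ≢ v → Anti G u v
    cross {u} {v} u∈T v∈U u≢v with u ∈? C | v ∈? C
    ... | yes u∈C | _       = stU (T→U u∈C u∈T) v∈U u≢v
    ... | no  _   | yes v∈C = stT u∈T (U→T v∈C v∈U) u≢v
    ... | no  u∉C | no  v∉C = cong antiᵇ (anti u v (XA-C⊆A (T⊆XA u∈T) u∉C) (XB-C⊆B (U⊆XB v∈U) v∉C))
    pairwise : ∀ {u v} → u ∈ T ∪ U → v ∈ T ∪ U → u ≢ v → Anti G u v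
    pairwise {u} {v} u∈ v∈ u≢v with x∈p∪q⁻ T U u∈ | x∈p∪q⁻ T U v∈
    ... | inj₁ u∈T | inj₁ v∈T = stT u∈T v∈T u≢v
    ... | inj₂ u∈U | inj₂ v∈U = stU u∈U v∈U u≢v
    ... | inj₁ u∈T | inj₂ v∈U = cross u∈T v∈U u≢v
    ... | inj₂ u∈U | inj₁ v∈T = trans (cong antiᵇ (θ-sym G u v)) (cross v∈T u∈U (λ e → u≢v (sym e)))
    traceA : (T ∪ U) ∩ XA ≡ T
    traceA = ⊆-antisym sub (λ u∈T → x∈p∩q⁺ (p⊆p∪q U u∈T , T⊆XA u∈T))
      where
      sub : (T ∪ U) ∩ XA ⊆ T
      sub u∈ with x∈p∩q⁻ (T ∪ U) XA u∈
      ... | u∈T∪U , u∈XA with x∈p∪q⁻ T U u∈T∪U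
      ...   | inj₁ u∈T = u∈T
      ...   | inj₂ u∈U = U→T (XA∩XB⊆C u∈XA (U⊆XB u∈U)) u∈U
    traceB : (T ∪ U) ∩ XB ≡ U
    traceB = ⊆-antisym sub (λ u∈U → x∈p∩q⁺ (q⊆p∪q T U u∈U , U⊆XB u∈U))
      where
      sub : (T ∪ U) ∩ XB ⊆ U
      sub u∈ with x∈p∩q⁻ (T ∪ U) XB u∈
      ... | u∈T∪U , u∈XB with x∈p∪q⁻ T U u∈T∪U
      ...   | inj₁ u∈T = T→U (XA∩XB⊆C (T⊆XA u∈T) u∈XB) u∈T
      ...   | inj₂ u∈U = u∈U

  α∅ αB : ℕ
  α∅ = αPart G w A C ⊥
  αB = α G XB (wB G w A C)

  αc : Fin n → ℕ
  αc c = αPart G w A C ⁅ c ⁆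

  wB′ : Weights n
  wB′ = wB G w A C

  A∪-⊆XA : ∀ {C′} → C′ ⊆ C → A ∪ C′ ⊆ XA
  A∪-⊆XA {C′} C′⊆C u∈ with x∈p∪q⁻ A C′ u∈
  ... | inj₁ u∈A  = p⊆p∪q C u∈A
  ... | inj₂ u∈C′ = q⊆p∪q A C (C′⊆C u∈C′)

  ⁅⁆⊆C : ∀ {c} → c ∈ C → ⁅ c ⁆ ⊆ C
  ⁅⁆⊆C {c} c∈C u∈ = subst (_∈ C) (sym (x∈⁅y⁆⇒x≡y c u∈)) c∈C

  αPart-isMax : ∀ {C′} → C′ ⊆ C → IsMaxStable G (A ∪ C′) XA w (αPart G w A C C′)
  αPart-isMax C′⊆C = red-isMax w bounded (A∪-⊆XA C′⊆C) G

  isMax∅ : IsMaxStable G A XA w α∅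
  isMax∅ = subst (λ R → IsMaxStable G R XA w α∅) (∪-identityʳ A) (αPart-isMax (⊆-min C))

  isMaxc : ∀ {c} → c ∈ C → IsMaxStable G (A ∪ ⁅ c ⁆) XA w (αc c)
  isMaxc c∈C = αPart-isMax (⁅⁆⊆C c∈C)

  α∅≤αc : ∀ {c} → c ∈ C → α∅ ≤ αc c
  α∅≤αc {c} c∈C = IsMaxStable-mono (p⊆p∪q ⁅ c ⁆) isMax∅ (isMaxc c∈C)

  wB-off : ∀ {u} → u ∉ C → wv wB′ u ≡ wv w u
  wB-off {u} u∉C = cong (λ b → if b then αc u ∸ α∅ else wv w u) (∉⇒mem u∉C)

  wB-on : ∀ {c} → c ∈ C → wv wB′ c ≡ αc c ∸ α∅
  wB-on {c} c∈C = cong (λ b → if b then αc c ∸ α∅ else wv w c) (∈⇒mem c∈C)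

  wt-wB-avoiding : ∀ {U} → (∀ u → u ∉ U ∩ C) → wt XB wB′ U ≡ wt XB w U
  wt-wB-avoiding {U} none = begin
    wt XB wB′ U                            ≡⟨ wt-split XB wB′ U ⟩
    vertexWt U (wv wB′) + pairPart XB w U  ≡⟨ cong (_+ pairPart XB w U) (vertexWt-cong off) ⟩
    vertexWt U (wv w) + pairPart XB w U    ≡⟨ wt-split XB w U ⟨
    wt XB w U                              ∎
    where
    open ≡-Reasoning
    off : ∀ u → u ∈ U → wv wB′ u ≡ wv w u
    off u u∈U = wB-off (λ u∈C → none u (x∈p∩q⁺ (u∈U , u∈C)))

  -- The defining property of w_B(c) = α_{A∪{c}} − α_A: moving the weight of
  -- the shared vertex c from the B side to the A side.
  exchange : ∀ {U c} → c ∈ U ∩ C → (∀ u → u ∈ U ∩ C → u ≡ c) →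
             α∅ + (wt XB wB′ U + wv w c) ≡ αc c + wt XB w U
  exchange {U} {c} c∈UC only = begin
    α∅ + (wt XB wB′ U + wv w c)                          ≡⟨ cong (λ x → α∅ + (x + wv w c)) (wt-split XB wB′ U) ⟩
    α∅ + ((vertexWt U (wv wB′) + pairPart XB w U) + wv w c) ≡⟨ cong (α∅ +_) (xy∙z≈xz∙y (vertexWt U (wv wB′)) _ _) ⟩
    α∅ + ((vertexWt U (wv wB′) + wv w c) + pairPart XB w U) ≡⟨ cong (λ x → α∅ + (x + pairPart XB w U)) swap ⟩
    α∅ + ((vertexWt U (wv w) + wv wB′ c) + pairPart XB w U) ≡⟨ cong (α∅ +_) (xy∙z≈xz∙y (vertexWt U (wv w)) _ _) ⟨
    α∅ + ((vertexWt U (wv w) + pairPart XB w U) + wv wB′ c) ≡⟨ cong (λ x → α∅ + (x + wv wB′ c)) (wt-split XB w U) ⟨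
    α∅ + (wt XB w U + wv wB′ c)                          ≡⟨ cong (λ x → α∅ + (wt XB w U + x)) (wB-on c∈C) ⟩
    α∅ + (wt XB w U + (αc c ∸ α∅))                       ≡⟨ x∙yz≈x∙zy α∅ (wt XB w U) (αc c ∸ α∅) ⟩
    α∅ + ((αc c ∸ α∅) + wt XB w U)                       ≡⟨ +-assoc α∅ _ _ ⟨
    (α∅ + (αc c ∸ α∅)) + wt XB w U                       ≡⟨ cong (_+ wt XB w U) (m+[n∸m]≡n (α∅≤αc c∈C)) ⟩
    αc c + wt XB w U                                     ∎
    where
    open ≡-Reasoning
    c∈C = proj₂ (x∈p∩q⁻ U C c∈UC)
    swap : vertexWt U (wv wB′) + wv w c ≡ vertexWt U (wv w) + wv wB′ c
    swap = vertexWt-swap (proj₁ (x∈p∩q⁻ U C c∈UC))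
             (λ u u∈U u≢c → wB-off (λ u∈C → u≢c (only u (x∈p∩q⁺ (u∈U , u∈C)))))

  upper : ∀ S → Stable G ⊤ S → wt ⊤ w S ≤ α∅ + αB
  upper S st with meetsC st
  ... | inj₁ none = begin
    wt ⊤ w S                                  ≡⟨ +-identityʳ _ ⟨
    wt ⊤ w S + 0                              ≡⟨ cong (wt ⊤ w S +_) (vertexWt-empty (wv w) none) ⟨
    wt ⊤ w S + vertexWt (S ∩ C) (wv w)        ≡⟨ decompose S ⟩
    wt XA w (S ∩ XA) + wt XB w (S ∩ XB)       ≡⟨ cong (wt XA w (S ∩ XA) +_) (wt-wB-avoiding noneB) ⟨
    wt XA w (S ∩ XA) + wt XB wB′ (S ∩ XB)     ≤⟨ +-mono-≤ (bound isMax∅ (S ∩ XA) stA) (bound (α-isMax G XB wB′) (S ∩ XB) stB) ⟩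
    α∅ + αB                                   ∎
    where
    open ≤-Reasoning
    stA : Stable G A (S ∩ XA)
    stA = Stable-⊆ {G = G} {X = ⊤} st (p∩q⊆p S XA)
            (λ u∈ → XA-C⊆A (p∩q⊆q S XA u∈) (λ u∈C → none _ (x∈p∩q⁺ (p∩q⊆p S XA u∈ , u∈C))))
    stB : Stable G XB (S ∩ XB)
    stB = Stable-⊆ {G = G} {X = ⊤} st (p∩q⊆p S XB) (p∩q⊆q S XB)
    noneB : ∀ u → u ∉ (S ∩ XB) ∩ C
    noneB u u∈ = none u (x∈p∩q⁺ (p∩q⊆p S XB (p∩q⊆p (S ∩ XB) C u∈) , p∩q⊆q (S ∩ XB) C u∈))
  ... | inj₂ (c , c∈SC , only) = +-cancelʳ-≤ (wv w c) _ _ (begin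
    wt ⊤ w S + wv w c                         ≡⟨ cong (wt ⊤ w S +_) (vertexWt-single (wv w) c∈SC only) ⟨
    wt ⊤ w S + vertexWt (S ∩ C) (wv w)        ≡⟨ decompose S ⟩
    wt XA w (S ∩ XA) + wt XB w (S ∩ XB)       ≤⟨ +-monoˡ-≤ _ (bound (isMaxc c∈C) (S ∩ XA) stA) ⟩
    αc c + wt XB w (S ∩ XB)                   ≡⟨ exchange c∈UC onlyU ⟨
    α∅ + (wt XB wB′ (S ∩ XB) + wv w c)        ≤⟨ +-monoʳ-≤ α∅ (+-monoˡ-≤ _ (bound (α-isMax G XB wB′) (S ∩ XB) stB)) ⟩
    α∅ + (αB + wv w c)                        ≡⟨ +-assoc α∅ αB _ ⟨
    (α∅ + αB) + wv w c                        ∎)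
    where
    open ≤-Reasoning
    c∈S = proj₁ (x∈p∩q⁻ S C c∈SC)
    c∈C = proj₂ (x∈p∩q⁻ S C c∈SC)
    stA : Stable G (A ∪ ⁅ c ⁆) (S ∩ XA)
    stA = Stable-⊆ {G = G} {X = ⊤} st (p∩q⊆p S XA) inside
      where
      inside : S ∩ XA ⊆ A ∪ ⁅ c ⁆
      inside {u} u∈ with u ∈? C
      ... | yes u∈C = q⊆p∪q A ⁅ c ⁆ (subst (_∈ ⁅ c ⁆) (sym (only u (x∈p∩q⁺ (p∩q⊆p S XA u∈ , u∈C)))) (x∈⁅x⁆ c))
      ... | no  u∉C = p⊆p∪q ⁅ c ⁆ (XA-C⊆A (p∩q⊆q S XA u∈) u∉C)
    stB : Stable G XB (S ∩ XB)
    stB = Stable-⊆ {G = G} {X = ⊤} st (p∩q⊆p S XB) (p∩q⊆q S XB)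
    c∈UC : c ∈ (S ∩ XB) ∩ C
    c∈UC = x∈p∩q⁺ (x∈p∩q⁺ (c∈S , q⊆p∪q B C c∈C) , c∈C)
    onlyU : ∀ u → u ∈ (S ∩ XB) ∩ C → u ≡ c
    onlyU u u∈ = only u (x∈p∩q⁺ (p∩q⊆p S XB (p∩q⊆p (S ∩ XB) C u∈) , p∩q⊆q (S ∩ XB) C u∈))

  extendAvoiding : ∀ {U} → Stable G XB U → (∀ u → u ∉ U ∩ C) →
                   Σ (Subset n) λ S → Stable G ⊤ S × α∅ + wt XB wB′ U ≤ wt ⊤ w S
  extendAvoiding {U} stU none with attained isMax∅
  ... | T , stT , opt = T ∪ U , stS , (begin
    α∅ + wt XB wB′ U                                  ≤⟨ +-monoˡ-≤ _ opt ⟩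
    wt XA w T + wt XB wB′ U                           ≡⟨ cong (wt XA w T +_) (wt-wB-avoiding none) ⟩
    wt XA w T + wt XB w U                             ≡⟨ cong₂ (λ X Y → wt XA w X + wt XB w Y) traceA traceB ⟨
    wt XA w ((T ∪ U) ∩ XA) + wt XB w ((T ∪ U) ∩ XB)   ≡⟨ decompose (T ∪ U) ⟨
    wt ⊤ w (T ∪ U) + vertexWt ((T ∪ U) ∩ C) (wv w)    ≡⟨ cong (wt ⊤ w (T ∪ U) +_) (vertexWt-empty (wv w) noneS) ⟩
    wt ⊤ w (T ∪ U) + 0                                ≡⟨ +-identityʳ _ ⟩
    wt ⊤ w (T ∪ U)                                    ∎)
    where
    open ≤-Reasoning
    glued : Stable G ⊤ (T ∪ U) × (T ∪ U) ∩ XA ≡ T × (T ∪ U) ∩ XB ≡ U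
    glued =
      glue (Stable-⊆ {G = G} {X = A} stT (λ u∈ → u∈) (λ u∈T → p⊆p∪q C (proj₁ stT u∈T))) stU
           (λ u∈C u∈T → ⊥-elim (disjAC _ (proj₁ stT u∈T) u∈C))
           (λ u∈C u∈U → ⊥-elim (none _ (x∈p∩q⁺ (u∈U , u∈C))))
    stS = proj₁ glued
    traceA = proj₁ (proj₂ glued)
    traceB = proj₂ (proj₂ glued)
    noneS : ∀ u → u ∉ (T ∪ U) ∩ C
    noneS u u∈ with x∈p∩q⁻ (T ∪ U) C u∈
    ... | u∈T∪U , u∈C with x∈p∪q⁻ T U u∈T∪U
    ...   | inj₁ u∈T = disjAC u (proj₁ stT u∈T) u∈C
    ...   | inj₂ u∈U = none u (x∈p∩q⁺ (u∈U , u∈C))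

  -- U meets C exactly in c, and an optimal stable set T of G[A ∪ {c}]
  -- contains c: gluing T and U realises the exchange of w(c) for w_B(c).
  extendThrough : ∀ {U T c} → Stable G XB U → c ∈ U ∩ C → (∀ u → u ∈ U ∩ C → u ≡ c) →
                  Stable G (A ∪ ⁅ c ⁆) T → αc c ≤ wt XA w T → c ∈ T →
                  Σ (Subset n) λ S → Stable G ⊤ S × α∅ + wt XB wB′ U ≤ wt ⊤ w S
  extendThrough {U} {T} {c} stU c∈UC only stT opt c∈T = T ∪ U , stS , +-cancelʳ-≤ (wv w c) _ _ (begin
    (α∅ + wt XB wB′ U) + wv w c                       ≡⟨ +-assoc α∅ _ _ ⟩
    α∅ + (wt XB wB′ U + wv w c)                       ≡⟨ exchange c∈UC only ⟩
    αc c + wt XB w U                                  ≤⟨ +-monoˡ-≤ _ opt ⟩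
    wt XA w T + wt XB w U                             ≡⟨ cong₂ (λ X Y → wt XA w X + wt XB w Y) traceA traceB ⟨
    wt XA w ((T ∪ U) ∩ XA) + wt XB w ((T ∪ U) ∩ XB)   ≡⟨ decompose (T ∪ U) ⟨
    wt ⊤ w (T ∪ U) + vertexWt ((T ∪ U) ∩ C) (wv w)    ≡⟨ cong (wt ⊤ w (T ∪ U) +_) (vertexWt-single (wv w) c∈S onlyS) ⟩
    wt ⊤ w (T ∪ U) + wv w c                           ∎)
    where
    open ≤-Reasoning
    c∈U = proj₁ (x∈p∩q⁻ U C c∈UC)
    c∈C = proj₂ (x∈p∩q⁻ U C c∈UC)
    stT′ : Stable G XA T
    stT′ = Stable-⊆ {G = G} {X = A ∪ ⁅ c ⁆} stT (λ u∈ → u∈) (λ u∈T → A∪-⊆XA (⁅⁆⊆C c∈C) (proj₁ stT u∈T))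
    onlyT : ∀ {u} → u ∈ C → u ∈ T → u ≡ c
    onlyT {u} u∈C u∈T with x∈p∪q⁻ A ⁅ c ⁆ (proj₁ stT u∈T)
    ... | inj₁ u∈A = ⊥-elim (disjAC u u∈A u∈C)
    ... | inj₂ u∈c = x∈⁅y⁆⇒x≡y c u∈c
    T→U : ∀ {u} → u ∈ C → u ∈ T → u ∈ U
    T→U u∈C u∈T = subst (_∈ U) (sym (onlyT u∈C u∈T)) c∈U
    U→T : ∀ {u} → u ∈ C → u ∈ U → u ∈ T
    U→T {u} u∈C u∈U = subst (_∈ T) (sym (only u (x∈p∩q⁺ (u∈U , u∈C)))) c∈T
    glued : Stable G ⊤ (T ∪ U) × (T ∪ U) ∩ XA ≡ T × (T ∪ U) ∩ XB ≡ U
    glued = glue stT′ stU T→U U→T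
    stS = proj₁ glued
    traceA = proj₁ (proj₂ glued)
    traceB = proj₂ (proj₂ glued)
    c∈S : c ∈ (T ∪ U) ∩ C
    c∈S = x∈p∩q⁺ (q⊆p∪q T U c∈U , c∈C)
    onlyS : ∀ u → u ∈ (T ∪ U) ∩ C → u ≡ c
    onlyS u u∈ with x∈p∩q⁻ (T ∪ U) C u∈
    ... | u∈T∪U , u∈C with x∈p∪q⁻ T U u∈T∪U
    ...   | inj₁ u∈T = onlyT u∈C u∈T
    ...   | inj₂ u∈U = only u (x∈p∩q⁺ (u∈U , u∈C))

  -- U meets C exactly in c, and an optimal stable set T of G[A ∪ {c}] misses
  -- c: then α_{A∪{c}} = α_A, so w_B(c) = 0 and c can be removed from U.
  dropC : ∀ {U T c} → Stable G XB U → c ∈ U ∩ C → (∀ u → u ∈ U ∩ C → u ≡ c) →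
          Stable G (A ∪ ⁅ c ⁆) T → αc c ≤ wt XA w T → c ∉ T →
          Stable G XB (U ∩ ∁ C) × (∀ u → u ∉ (U ∩ ∁ C) ∩ C) × wt XB wB′ U ≤ wt XB wB′ (U ∩ ∁ C)
  dropC {U} {T} {c} stU c∈UC only stT opt c∉T =
    Stable-⊆ {G = G} {X = XB} stU (p∩q⊆p U (∁ C)) (λ u∈ → proj₁ stU (p∩q⊆p U (∁ C) u∈)) ,
    (λ u u∈ → x∈∁p⇒x∉p (p∩q⊆q U (∁ C) (p∩q⊆p (U ∩ ∁ C) C u∈)) (p∩q⊆q (U ∩ ∁ C) C u∈)) ,
    wt-drop wB′ bounded (p∩q⊆p U (∁ C)) (proj₁ stU) weightless
    where
    T⊆A : T ⊆ A
    T⊆A u∈T with x∈p∪q⁻ A ⁅ c ⁆ (proj₁ stT u∈T)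
    ... | inj₁ u∈A = u∈A
    ... | inj₂ u∈c = ⊥-elim (c∉T (subst (_∈ T) (x∈⁅y⁆⇒x≡y c u∈c) u∈T))
    wB-c : wv wB′ c ≡ 0
    wB-c = trans (wB-on (proj₂ (x∈p∩q⁻ U C c∈UC)))
                 (m≤n⇒m∸n≡0 (≤-trans opt (bound isMax∅ T (Stable-⊆ {G = G} {X = A ∪ ⁅ c ⁆} stT (λ u∈ → u∈) T⊆A))))
    weightless : ∀ u → u ∈ U → u ∉ U ∩ ∁ C → wv wB′ u ≡ 0
    weightless u u∈U u∉ with u ∈? C
    ... | yes u∈C = subst (λ x → wv wB′ x ≡ 0) (sym (only u (x∈p∩q⁺ (u∈U , u∈C)))) wB-c
    ... | no  u∉C = ⊥-elim (u∉ (x∈p∩q⁺ (u∈U , x∉p⇒x∈∁p u∉C)))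

  extendMeeting : ∀ {U c} → Stable G XB U → c ∈ U ∩ C → (∀ u → u ∈ U ∩ C → u ≡ c) →
                  Σ (Subset n) λ S → Stable G ⊤ S × α∅ + wt XB wB′ U ≤ wt ⊤ w S
  extendMeeting {U} {c} stU c∈UC only = byOptimal (attained (isMaxc (proj₂ (x∈p∩q⁻ U C c∈UC))))
    where
    byOptimal : (Σ (Subset n) λ T → Stable G (A ∪ ⁅ c ⁆) T × αc c ≤ wt XA w T) →
                Σ (Subset n) λ S → Stable G ⊤ S × α∅ + wt XB wB′ U ≤ wt ⊤ w S
    byOptimal (T , stT , optT) with c ∈? T
    ... | yes c∈T = extendThrough stU c∈UC only stT optT c∈T
    ... | no  c∉T = let (stU′ , none′ , U≤U′) = dropC stU c∈UC only stT optT c∉T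
                        (S , stS , le) = extendAvoiding stU′ none′
                    in S , stS , ≤-trans (+-monoʳ-≤ α∅ U≤U′) le

  lower : Σ (Subset n) λ S → Stable G ⊤ S × α∅ + αB ≤ wt ⊤ w S
  lower = byOptimal (attained (α-isMax G XB wB′))
    where
    byOptimal : (Σ (Subset n) λ U → Stable G XB U × αB ≤ wt XB wB′ U) →
                Σ (Subset n) λ S → Stable G ⊤ S × α∅ + αB ≤ wt ⊤ w S
    byOptimal (U , stU , optU) =
      let (S , stS , le) = extend (meetsC stU) in S , stS , ≤-trans (+-monoʳ-≤ α∅ optU) le
      where
      extend : (∀ u → u ∉ U ∩ C) ⊎ Σ (Fin n) (λ c → c ∈ U ∩ C × (∀ u → u ∈ U ∩ C → u ≡ c)) →
               Σ (Subset n) λ S → Stable G ⊤ S × α∅ + wt XB wB′ U ≤ wt ⊤ w S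
      extend (inj₁ none)                = extendAvoiding stU none
      extend (inj₂ (c , c∈UC , only))   = extendMeeting stU c∈UC only

  split-isMax : IsMaxStable G ⊤ ⊤ w (α∅ + αB)
  split-isMax = record { bound = upper ; attained = lower }

-- The first part says that w_B(c) = α_{A∪{c}} − α_A loses nothing to
-- truncation; w_B is a weight function because it keeps the pair weights of
-- w; and α(G, w) = α_A + α(G_B, w_B) since both are the maximum weight of a
-- stable set of G.
lemma3p10 : ∀ {n} (G : Trigraph n) (w : Weights n) (A B C : Subset n) →
    IsWeightFunction G w →
    CliqueCutset G C →
    CutPartition G A B C →
    ((∀ c → c ∈ C → αPart G w A C ⊥ ≤ αPart G w A C ⁅ c ⁆)
    × IsWeightFunctionOn G (B ∪ C) (wB G w A C))
    × α G ⊤ w ≡ αPart G w A C ⊥ + α G (B ∪ C) (wB G w A C)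
lemma3p10 G w A B C isWF (clique , _) cp =
  ((λ c c∈C → α∅≤αc c∈C) , (λ u v _ _ u≢v → isWF u v ∈⊤ ∈⊤ u≢v)) ,
  IsMaxStable-unique (α-isMax G ⊤ w) split-isMax
  where open CliqueCutsetSplit G w isWF clique cp
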